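{- Let $\mathcal V_z=\langle A,a_z,\delta,\vec x_{in}\rangle$ be a VASZ of dimension $d$ with $\vec x_{in}\in\{0\}\times\mathbb N^{d-1}$ and $\delta(a_z)\in\{0\}\times\mathbb Z^{d-1}$, let $\mathcal V=\langle A,\delta|_A,\vec x_{in}\rangle$ be the VAS obtained by removing the zero-test, and let $\vec f=(0,\omega,\dots,\omega)$. If $\vec R$ is a basis of $\downarrow_{\vec f}\mathrm{Post}^*(\mathcal V_z)$, then $\mathrm{Cover}(\mathcal V_z)=\mathbb N^d\cap\bigcup_{\vec r\in\vec R}\downarrow\mathrm{Post}^*(\mathcal V(\vec r))$.
   Context: A VASZ of dimension $d$ is $\langle A,a_z,\delta,\vec x_{in}\rangle$ with $A$ finite, $a_z\notin A$, $\delta:A\cup\{a_z\}\to\mathbb Z^d$; $\vec x\xrightarrow{a}\vec y$ iff $\vec y-\vec x=\delta(a)$ for $a\in A$, and $\vec x\xrightarrow{a_z}\vec y$ iff $\vec y-\vec x=\delta(a_z)$ and $\vec x(1)=0$; extended to words by composition. A VAS is the same without $a_z$. Initial states and states may lie in $\mathbb N_\omega^d$ ($\mathbb N_\omega=\mathbb N\cup\{\omega\}$), with $\omega+n=n+\omega=\omega$ for $n\in\mathbb Z$ and $\omega\ge0$; for $\vec r\in\mathbb N_\omega^d$, $\mathcal V(\vec r)$ is $\mathcal V$ with initial state $\vec r$, and $\mathrm{Post}^*$ is the set of states reachable from the initial state. $\mathrm{Cover}(\mathcal V_z)=\downarrow\mathrm{Post}^*(\mathcal V_z)\cap\mathbb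 N^d$, $\downarrow$ being downward closure for the componentwise order on $\mathbb N_\omega^d$ ($n\le\omega$). For $\vec f\in\mathbb N_\omega^d$: $\vec M|_{\vec f}=\{\vec x\in\vec M\mid\forall i,\ \vec f(i)<\omega\Rightarrow\vec x(i)=\vec f(i)\}$, $\downarrow_{\vec f}\vec M=\downarrow(\vec M|_{\vec f})$. Convergence in $\mathbb N_\omega$: ultimately constant equal to $\ell$, or integer subsequence infinite tending to infinity with $\ell=\omega$; componentwise in $\mathbb N_\omega^d$; $\mathrm{Lim}\,\vec M$ is the set of limits of sequences from $\vec M$. A basis of $\vec D$ is a finite $\vec B\subseteq\mathbb N_\omega^d$ with $\mathrm{Lim}\,\vec D=\downarrow\vec B$. -}

module Defs where

open import Data.Nat as ℕ using (ℕ; zero; suc)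
open import Data.Integer as ℤ using (ℤ; +_)
open import Data.Fin using (Fin; zero; suc)
open import Data.Product using (Σ; ∃; _×_; _,_)
open import Data.Sum using (_⊎_)
open import Data.List using (List)
open import Data.List.Relation.Unary.Any using (Any)
open import Relation.Binary.PropositionalEquality using (_≡_)
open import Relation.Binary.Construct.Closure.ReflexiveTransitive using (Star)
open import Function.Bundles using (_⇔_)

data ℕω : Set where
  fin : ℕ → ℕω
  ω   : ℕω

IsFin : ℕω → Set
IsFin x = ∃ λ k → x ≡ fin k

data _≤ω_ : ℕω → ℕω → Set where
  fin≤fin : ∀ {m n} → m ℕ.≤ n → fin m ≤ω fin n
  ≤ω-top  : ∀ {x} → x ≤ω ω

-- AddTo x z y  :  y = x + z  in ℕ_ω  (ω + z = ω; the result must be in ℕ_ω)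
data AddTo : ℕω → ℤ → ℕω → Set where
  add-fin : ∀ {m n z} → + n ≡ + m ℤ.+ z → AddTo (fin m) z (fin n)
  add-ω   : ∀ {z} → AddTo ω z ω

Vecω : ℕ → Set
Vecω d = Fin d → ℕω

AllFin : ∀ {d} → Vecω d → Set
AllFin x = ∀ i → IsFin (x i)

_≤ᵥ_ : ∀ {d} → Vecω d → Vecω d → Set
x ≤ᵥ y = ∀ i → x i ≤ω y i

Shift : ∀ {d} → Vecω d → (Fin d → ℤ) → Vecω d → Set
Shift x v y = ∀ i → AddTo (x i) (v i) (y i)

Down : ∀ {d} → (Vecω d → Set) → Vecω d → Set
Down M x = ∃ λ y → M y × x ≤ᵥ y

Restrict : ∀ {d} → Vecω d → (Vecω d → Set) → Vecω d → Set
Restrict f M x = M x × (∀ i k → f i ≡ fin k → x i ≡ fin k)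

DownF : ∀ {d} → Vecω d → (Vecω d → Set) → Vecω d → Set
DownF f M = Down (Restrict f M)

Converges : (ℕ → ℕω) → ℕω → Set
Converges s ℓ =
  (∃ λ N → ∀ n → N ℕ.≤ n → s n ≡ ℓ)
  ⊎ (ℓ ≡ ω
     × (∀ N → ∃ λ n → N ℕ.≤ n × IsFin (s n))
     × (∀ B → ∃ λ N → ∀ n k → N ℕ.≤ n → s n ≡ fin k → B ℕ.≤ k))

ConvergesV : ∀ {d} → (ℕ → Vecω d) → Vecω d → Set
ConvergesV s ℓ = ∀ i → Converges (λ n → s n i) (ℓ i)

Lim : ∀ {d} → (Vecω d → Set) → Vecω d → Set
Lim D ℓ = ∃ λ (s : ℕ → Vecω _) → (∀ n → D (s n)) × ConvergesV s ℓ

DownList : ∀ {d} → List (Vecω d) → Vecω d → Set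
DownList B x = Any (λ b → x ≤ᵥ b) B

IsBasis : ∀ {d} → (Vecω d → Set) → List (Vecω d) → Set
IsBasis D B = ∀ x → Lim D x ⇔ DownList B x

-- VAS and VASZ.  Actions A = Fin nA; a VASZ has dimension (suc d), the
-- zero test being on the first coordinate (index zero).

record VAS (d : ℕ) : Set where
  field
    nA  : ℕ
    δ   : Fin nA → Fin d → ℤ
    xin : Vecω d

record VASZ (d : ℕ) : Set where
  field
    nA  : ℕ
    δ   : Fin nA → Fin (suc d) → ℤ
    δz  : Fin (suc d) → ℤ
    xin : Vecω (suc d)

data Step {d} (V : VAS d) : Vecω d → Vecω d → Set where
  act : ∀ a {x y} → Shift x (VAS.δ V a) y → Step V x y

data StepZ {d} (V : VASZ d) : Vecω (suc d) → Vecω (suc d) → Set where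
  act   : ∀ a {x y} → Shift x (VASZ.δ V a) y → StepZ V x y
  ztest : ∀ {x y} → x zero ≡ fin 0 → Shift x (VASZ.δz V) y → StepZ V x y

Post : ∀ {d} → VAS d → Vecω d → Set
Post V y = Star (Step V) (VAS.xin V) y

PostZ : ∀ {d} → VASZ d → Vecω (suc d) → Set
PostZ V y = Star (StepZ V) (VASZ.xin V) y

CoverZ : ∀ {d} → VASZ d → Vecω (suc d) → Set
CoverZ V x = AllFin x × Down (PostZ V) x

forget : ∀ {d} → VASZ d → VAS (suc d)
forget V = record { nA = VASZ.nA V ; δ = VASZ.δ V ; xin = VASZ.xin V }

withInit : ∀ {d} → VAS d → Vecω d → VAS d
withInit V r = record { nA = VAS.nA V ; δ = VAS.δ V ; xin = r }

fvec : ∀ {d} → Vecω (suc d)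
fvec zero    = fin 0
fvec (suc i) = ω

-- (⊆) Cut a run of V_z at its last zero test (or at its start).  The state w
-- reached there is reachable, has w(1) = 0, and the remainder is a run of
-- the plain VAS V.  Hence w ∈ ↓_f Post*(V_z) ⊆ Lim ⊆ ↓R, so w ≤ r for some
-- r ∈ R, and by monotonicity of VAS runs the remainder can be replayed
-- from r, reaching a state above the covered one.
--
-- (⊇) A run of V from r ∈ R covering a finite x only inspects finitely many
-- values: it can be replayed from any state u that is ≥ r on the finite
-- coordinates of r and ≥ some threshold B on its ω-coordinates.  Since r is
-- a limit of states below reachable states of V_z, some reachable t of V_z
-- is such a state, and the replayed run, being free of zero tests, is a run
-- of V_z from t.
module Submission where

open import Defs
open import Data.Integer using (+_)
open import Data.Nat using (suc)
open import Data.Fin using (zero)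
open import Data.Product using (_×_)
open import Data.List using (List)
open import Data.List.Relation.Unary.Any using (Any)
open import Relation.Binary.PropositionalEquality using (_≡_)
open import Function.Bundles using (_⇔_)

open import Data.Nat as ℕ using (ℕ; _≤_; _+_; _⊔_; z≤n)
open import Data.Nat.Properties using (≤-refl; ≤-trans; m≤m+n; m≤n+m; m≤m⊔n; m≤n⊔m; m+n∸n≡m)
open import Data.Integer as ℤ using (-[1+_]; ∣_∣; +≤+)
open import Data.Integer.Properties as ℤP using (0≤i⇒+∣i∣≡i; drop‿+≤+; ⊖-≥)
open import Data.Fin using (Fin; suc)
open import Data.Product using (∃; _,_; proj₁; proj₂)
open import Data.Sum using (inj₁; inj₂)
open import Data.List.Membership.Propositional using (find; lose)
import Data.List.Relation.Unary.Any as Any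
open import Relation.Binary.PropositionalEquality using (refl; sym; trans; cong; subst)
open import Relation.Binary.Construct.Closure.ReflexiveTransitive using (Star; ε; _◅_; _◅◅_; map; return)
open import Function.Bundles using (mk⇔; Equivalence)

≤ω-refl : ∀ a → a ≤ω a
≤ω-refl (fin k) = fin≤fin ≤-refl
≤ω-refl ω       = ≤ω-top

≤ω-trans : ∀ {a b c} → a ≤ω b → b ≤ω c → a ≤ω c
≤ω-trans (fin≤fin p) (fin≤fin q) = fin≤fin (≤-trans p q)
≤ω-trans _           ≤ω-top      = ≤ω-top

≤ᵥ-refl : ∀ {d} (x : Vecω d) → x ≤ᵥ x
≤ᵥ-refl x i = ≤ω-refl (x i)

≤ᵥ-trans : ∀ {d} {x y z : Vecω d} → x ≤ᵥ y → y ≤ᵥ z → x ≤ᵥ z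
≤ᵥ-trans p q i = ≤ω-trans (p i) (q i)

assemble : ∀ {d} {P Q : Fin d → ℕω → Set}
  → (∀ i → ∃ λ e → P i e × Q i e)
  → ∃ λ (v : Vecω d) → (∀ i → P i (v i)) × (∀ i → Q i (v i))
assemble h = (λ i → proj₁ (h i)) , (λ i → proj₁ (proj₂ (h i))) , (λ i → proj₂ (proj₂ (h i)))

addTo-fin : ∀ {m z} → + 0 ℤ.≤ + m ℤ.+ z → AddTo (fin m) z (fin ∣ + m ℤ.+ z ∣)
addTo-fin 0≤m+z = add-fin (0≤i⇒+∣i∣≡i 0≤m+z)

addTo-mono : ∀ {a z b c} → AddTo a z b → a ≤ω c → ∃ λ e → AddTo c z e × b ≤ω e
addTo-mono _ ≤ω-top = ω , add-ω , ≤ω-top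
addTo-mono (add-fin {n = n} {z} n≡m+z) (fin≤fin {n = m′} m≤m′) =
  fin ∣ + m′ ℤ.+ z ∣ , addTo-fin 0≤m′+z , fin≤fin (drop‿+≤+ n≤∣m′+z∣)
  where
  n≤m′+z : + n ℤ.≤ + m′ ℤ.+ z
  n≤m′+z = subst (ℤ._≤ + m′ ℤ.+ z) (sym n≡m+z) (ℤP.+-monoˡ-≤ z (+≤+ m≤m′))
  0≤m′+z : + 0 ℤ.≤ + m′ ℤ.+ z
  0≤m′+z = ℤP.≤-trans (+≤+ z≤n) n≤m′+z
  n≤∣m′+z∣ : + n ℤ.≤ + ∣ + m′ ℤ.+ z ∣
  n≤∣m′+z∣ = subst (+ n ℤ.≤_) (sym (0≤i⇒+∣i∣≡i 0≤m′+z)) n≤m′+z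

addTo-threshold : ∀ b z → ∃ λ k → AddTo (fin (b + ∣ z ∣)) z (fin k) × b ≤ k
addTo-threshold b (+ j)     = b + j + j , add-fin refl , ≤-trans (m≤m+n b j) (m≤m+n (b + j) j)
addTo-threshold b -[1+ j ] = b , add-fin b≡b+j⊖j , ≤-refl
  where
  b≡b+j⊖j : + b ≡ + (b + suc j) ℤ.+ -[1+ j ]
  b≡b+j⊖j = sym (trans (⊖-≥ (m≤n+m (suc j) b)) (cong +_ (m+n∸n≡m b (suc j))))

shift-mono : ∀ {d} {x : Vecω d} {v y c} → Shift x v y → x ≤ᵥ c
  → ∃ λ y′ → Shift c v y′ × y ≤ᵥ y′
shift-mono sh x≤c = assemble (λ i → addTo-mono (sh i) (x≤c i))

run-mono : ∀ {d} (W : VAS d) {w y c} → Star (Step W) w y → w ≤ᵥ c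
  → ∃ λ y′ → Star (Step W) c y′ × y ≤ᵥ y′
run-mono W ε w≤c = _ , ε , w≤c
run-mono W (act a sh ◅ rest) w≤c with shift-mono sh w≤c
... | c₁ , sh′ , w₁≤c₁ with run-mono W rest w₁≤c₁
...   | y′ , rest′ , y≤y′ = y′ , act a sh′ ◅ rest′ , y≤y′

-- Replacing ω by a threshold b: `approx b ℓ ≤ω v` says v is above ℓ where ℓ
-- is finite, and at least b where ℓ = ω.  States approximating an ω-state
-- this way can replay its runs, provided the thresholds are large enough.

approx : ℕ → ℕω → ℕω
approx b (fin k) = fin k
approx b ω       = fin b

approxᵥ : ∀ {d} → (Fin d → ℕ) → Vecω d → Vecω d
approxᵥ B r i = approx (B i) (r i)

approx-≤ : ∀ b ℓ → approx b ℓ ≤ω ℓ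
approx-≤ b (fin k) = ≤ω-refl (fin k)
approx-≤ b ω       = ≤ω-top

below-approx : ∀ {a b ℓ} → a ≡ fin b → a ≤ω ℓ → a ≤ω approx b ℓ
below-approx refl (fin≤fin b≤k) = fin≤fin b≤k
below-approx refl ≤ω-top        = fin≤fin ≤-refl

-- One update: the threshold grows by |z| per step backwards along a run.
addTo-approx : ∀ {b r z r₁ u} → AddTo r z r₁ → approx (b + ∣ z ∣) r ≤ω u
  → ∃ λ u₁ → AddTo u z u₁ × approx b r₁ ≤ω u₁
addTo-approx (add-fin eq) r≤u = addTo-mono (add-fin eq) r≤u
addTo-approx {b} {z = z} add-ω b+z≤u with addTo-threshold b z
... | k , step , b≤k with addTo-mono step b+z≤u
...   | u₁ , step′ , k≤u₁ = u₁ , step′ , ≤ω-trans (fin≤fin b≤k) k≤u₁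

shift-approx : ∀ {d} {B : Fin d → ℕ} {r v r₁ u}
  → Shift r v r₁ → approxᵥ (λ i → B i + ∣ v i ∣) r ≤ᵥ u
  → ∃ λ u₁ → Shift u v u₁ × approxᵥ B r₁ ≤ᵥ u₁
shift-approx sh r≤u = assemble (λ i → addTo-approx (sh i) (r≤u i))

run-robust : ∀ {d} (W : VAS d) {r y x} → Star (Step W) r y → AllFin x → x ≤ᵥ y
  → ∃ λ B → ∀ {u} → approxᵥ B r ≤ᵥ u → ∃ λ y′ → Star (Step W) u y′ × x ≤ᵥ y′
run-robust W {r} {x = x} ε x-fin x≤r = threshold , x≤u
  where
  threshold : Fin _ → ℕ
  threshold i = proj₁ (x-fin i)
  x≤u : ∀ {u} → approxᵥ threshold r ≤ᵥ u → ∃ λ y′ → Star (Step W) u y′ × x ≤ᵥ y′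
  x≤u r≤u = _ , ε , λ i → ≤ω-trans (below-approx (proj₂ (x-fin i)) (x≤r i)) (r≤u i)
run-robust W {r} {x = x} (act a sh ◅ rest) x-fin x≤y with run-robust W rest x-fin x≤y
... | B₁ , replay = threshold , replay-from
  where
  threshold : Fin _ → ℕ
  threshold i = B₁ i + ∣ VAS.δ W a i ∣
  replay-from : ∀ {u} → approxᵥ threshold r ≤ᵥ u → ∃ λ y′ → Star (Step W) u y′ × x ≤ᵥ y′
  replay-from r≤u with shift-approx {B = B₁} sh r≤u
  ... | u₁ , sh′ , r₁≤u₁ with replay r₁≤u₁
  ...   | y′ , rest′ , x≤y′ = y′ , act a sh′ ◅ rest′ , x≤y′

converges-approx : ∀ {s ℓ} b → Converges s ℓ → ∃ λ N → ∀ n → N ≤ n → approx b ℓ ≤ω s n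
converges-approx {ℓ = ℓ} b (inj₁ (N , constant)) =
  N , λ n N≤n → subst (approx b ℓ ≤ω_) (sym (constant n N≤n)) (approx-≤ b ℓ)
converges-approx {s} b (inj₂ (refl , _ , unbounded)) with unbounded b
... | N , large = N , λ n N≤n → above (s n) (λ k → large n k N≤n)
  where
  above : ∀ v → (∀ k → v ≡ fin k → b ≤ k) → fin b ≤ω v
  above (fin k) b≤ = fin≤fin (b≤ k refl)
  above ω       _  = ≤ω-top

eventually-all : ∀ {d} (P : Fin d → ℕ → Set) → (∀ i → ∃ λ N → ∀ n → N ≤ n → P i n)
  → ∃ λ N → ∀ i n → N ≤ n → P i n
eventually-all {ℕ.zero} P h = 0 , λ ()
eventually-all {suc d}  P h with h zero | eventually-all (λ i → P (suc i)) (λ i → h (suc i))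
... | N₀ , h₀ | N , hₛ = N₀ ⊔ N , λ where
  zero    n N≤n → h₀ n (≤-trans (m≤m⊔n N₀ N) N≤n)
  (suc i) n N≤n → hₛ i n (≤-trans (m≤n⊔m N₀ N) N≤n)

limit-approx : ∀ {d} {M : Vecω d → Set} {r} → Lim (Down M) r
  → ∀ B → ∃ λ t → M t × approxᵥ B r ≤ᵥ t
limit-approx (s , below , converges) B
  with eventually-all (λ i n → approx (B i) _ ≤ω s n i) (λ i → converges-approx (B i) (converges i))
... | N , eventually with below N
...   | t , Mt , sN≤t = t , Mt , ≤ᵥ-trans (λ i → eventually i N ≤-refl) sN≤t

self-limit : ∀ {d} {D : Vecω d → Set} {x} → D x → Lim D x
self-limit {x = x} Dx = (λ _ → x) , (λ _ → Dx) , λ i → inj₁ (0 , λ _ _ → refl)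

zero-free-step : ∀ {d} (V : VASZ d) {r x y} → Step (withInit (forget V) r) x y → StepZ V x y
zero-free-step V (act a sh) = act a sh

reinit-step : ∀ {d} (W : VAS d) {r x y} → Step W x y → Step (withInit W r) x y
reinit-step W (act a sh) = act a sh

Anchored : ∀ {d} → VASZ d → Vecω (suc d) → Set
Anchored V y = ∃ λ w → PostZ V w × w zero ≡ fin 0 × Star (Step (forget V)) w y

anchored-reachable : ∀ {d} (V : VASZ d) {y} → Anchored V y → PostZ V y
anchored-reachable V (w , reach-w , _ , run) = reach-w ◅◅ map (zero-free-step V) run

-- When the zero test leaves the first counter unchanged, a zero test ends in a
-- state whose first counter is still 0, which becomes the new anchor.
anchored-step : ∀ {d} (V : VASZ d) → VASZ.δz V zero ≡ + 0
  → ∀ {a b} → Anchored V a → StepZ V a b → Anchored V b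
anchored-step V δz₀ (w , reach-w , w₀ , run) (act a sh) =
  w , reach-w , w₀ , run ◅◅ return (act a sh)
anchored-step V δz₀ anchored-a (ztest {y = b} a₀ sh) =
  b , reach-b , stays-zero a₀ δz₀ (sh zero) , ε
  where
  reach-b : PostZ V b
  reach-b = anchored-reachable V anchored-a ◅◅ return (ztest a₀ sh)
  stays-zero : ∀ {c z e} → c ≡ fin 0 → z ≡ + 0 → AddTo c z e → e ≡ fin 0
  stays-zero refl refl (add-fin eq) = cong fin (ℤP.+-injective eq)

anchored-run : ∀ {d} (V : VASZ d) → VASZ.δz V zero ≡ + 0
  → ∀ {a y} → Anchored V a → Star (StepZ V) a y → Anchored V y
anchored-run V δz₀ anchored ε            = anchored
anchored-run V δz₀ anchored (step ◅ run) = anchored-run V δz₀ (anchored-step V δz₀ anchored step) run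

reachable-anchored : ∀ {d} (V : VASZ d) → VASZ.xin V zero ≡ fin 0 → VASZ.δz V zero ≡ + 0
  → ∀ {y} → PostZ V y → Anchored V y
reachable-anchored V xin₀ δz₀ = anchored-run V δz₀ (VASZ.xin V , ε , xin₀ , ε)

zero-state-in-DownF : ∀ {d} (V : VASZ d) {w} → PostZ V w → w zero ≡ fin 0
  → DownF fvec (PostZ V) w
zero-state-in-DownF V {w} reach-w w₀ = w , (reach-w , agrees) , ≤ᵥ-refl w
  where
  agrees : ∀ i k → fvec i ≡ fin k → w i ≡ fin k
  agrees zero    k refl = w₀
  agrees (suc i) k ()

lemma6p1 : ∀ {d} (V : VASZ d)
    → VASZ.xin V zero ≡ fin 0
    → AllFin (VASZ.xin V)
    → VASZ.δz V zero ≡ + 0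
    → (R : List (Vecω (suc d)))
    → IsBasis (DownF fvec (PostZ V)) R
    → ∀ x → CoverZ V x ⇔ (AllFin x × Any (λ r → Down (Post (withInit (forget V) r)) x) R)
lemma6p1 V xin₀ _ δz₀ R basis x = mk⇔ covered-by-basis covered-from-basis
  where
  covered-by-basis : CoverZ V x → AllFin x × Any (λ r → Down (Post (withInit (forget V) r)) x) R
  covered-by-basis (x-fin , y , reach-y , x≤y) with reachable-anchored V xin₀ δz₀ reach-y
  ... | w , reach-w , w₀ , run = x-fin , Any.map replay-from w≤R
    where
    w≤R = Equivalence.to (basis w) (self-limit (zero-state-in-DownF V reach-w w₀))
    replay-from : ∀ {r} → w ≤ᵥ r → Down (Post (withInit (forget V) r)) x
    replay-from w≤r with run-mono (forget V) run w≤r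
    ... | y′ , run′ , y≤y′ = y′ , map (reinit-step (forget V)) run′ , ≤ᵥ-trans x≤y y≤y′

  covered-from-basis : AllFin x × Any (λ r → Down (Post (withInit (forget V) r)) x) R → CoverZ V x
  covered-from-basis (x-fin , x≤R) with find x≤R
  ... | r , r∈R , y , run , x≤y with run-robust (withInit (forget V) r) run x-fin x≤y
  ...   | B , replay with limit-approx (Equivalence.from (basis r) (lose r∈R (≤ᵥ-refl r))) B
  ...     | t , (reach-t , _) , r≈t with replay r≈t
  ...       | y′ , run′ , x≤y′ = x-fin , y′ , reach-t ◅◅ map (zero-free-step V) run′ , x≤y′
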